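{- Let $\mathcal H$ be any frame (not necessarily complete) expanding the first-order $\Sigma$-structure $\mathcal A$, and let $\Gamma$ be a set of HoCHCs. If $\Gamma\Rightarrow^*\Gamma'\cup\{\bot\}$ for some $\Gamma'$, then $\Gamma$ is $(\mathcal A,\mathcal H)$-unsatisfiable.
   Context: Types. Fix a single base type $\iota$. Argument types $\tau::=\iota\mid\rho$; relational types $\rho::=o\mid\tau\to\rho$; first-order types $\sigma_{FO}::=\iota\mid\iota\to o\mid\iota\to\sigma_{FO}$; types $\sigma::=\rho\mid\sigma_{FO}$. A fixed type environment $\Delta$ maps variables to argument types, with $\Delta^{ -1}(\tau)$ infinite for each argument type $\tau$. A signature is a set of typed symbols $c:\sigma$ distinct from variables and from the logical symbols $\neg,\land,\lor,\exists_\tau$; it is first-order if all its types are first-order. Terms. Pre-terms $M::=x\mid c\mid\neg\mid\land\mid\lor\mid\exists_\tau\mid MM\mid\lambda x.M$, typed by: $x:\Delta(x)$; $c:\sigma$; $M_1M_2:\sigma_2$ if $M_1:\sigma_1\to\sigma_2$, $M_2:\sigma_1$; $\lambda x.M:\Delta(x)\to\rho$ if $M:\rho$, $\rho$ relational; $\land,\lor:o\to o\to o$; $\neg M:o$ if $M:o$; $\exists_\tau:(\tau\to o)\to o$. Formulas are terms of type $o$. A first-order $\Sigma$-formula uses only symbols of first-order type, variables of type $\iota$, no $\lambda$. Positive existential: $\neg$ does not occur. Semantics. A pre-frame $\mathcal H$ assigns nonempty sets $\mathcal H[\![\sigma]\!]$ with $\mathcal H[\![o]\!]=\{0,1\}$,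 $\mathcal H[\![\sigma_1\to\sigma_2]\!]$ a set of functions, containing $\min,\max\in\mathcal H[\![o\to o\to o]\!]$ and $E_\tau(r)=\max\{r(s)\mid s\in\mathcal H[\![\tau]\!]\}\in\mathcal H[\![(\tau\to o)\to o]\!]$. Structures, valuations and denotations $[\![M]\!]^{\mathcal B}(\alpha)$ are standard; $[\![\lambda x.M]\!]^{\mathcal B}(\alpha)$ is $r\mapsto[\![M]\!]^{\mathcal B}(\alpha[x\mapsto r])$ if that lies in the frame, otherwise arbitrary. $\mathcal B\models F$ iff $[\![F]\!]^{\mathcal B}(\alpha)=1$ for all valuations $\alpha$. A frame is a pre-frame with $[\![\lambda x.M]\!]^{\mathcal B}(\alpha)(r)=[\![M]\!]^{\mathcal B}(\alpha[x\mapsto r])$ for all positive existential $\lambda x.M$, all structures, valuations and $r$. Background. Fix a first-order signature $\Sigma$, a first-order $\Sigma$-structure $\mathcal A$, and $\Sigma'\supseteq\Sigma$ adding only symbols of relational type. A frame $\mathcal H$ expands $\mathcal A$ if $\mathcal H[\![\iota]\!]=\mathcal A[\![\iota]\!]$ and $c^{\mathcal A}\in\mathcal H[\![\sigma]\!]$ for $c:\sigma\in\Sigma$; a $(\Sigma',\mathcal H)$-expansion of $\mathcal A$ is a $(\Sigma',\mathcal H)$-structure agreeing with $\mathcal A$ on $\Sigma$. Clauses. An atom is a $\Sigma'$-formula with no logical symbol; a background atom is one that is a first-order $\Sigma$-formula. Goal clause: $\neg A_1\lor\cdots\lor\neg A_n$ ($\bot$ if $n=0$); definite clause: $G\lor R\,x_1\cdots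 x_n$, $G$ a goal clause, $R\in\Sigma'\setminus\Sigma$, $x_i$ distinct variables; HoCHC: goal or definite clause, free variables universally quantified. $\Gamma$ is $(\mathcal A,\mathcal H)$-satisfiable if some $(\Sigma',\mathcal H)$-expansion of $\mathcal A$ satisfies every clause of $\Gamma$. Proof system (modulo renaming of free variables): Resolution: from $\neg R\,M_1\cdots M_n\lor G$ and $G'\lor R\,x_1\cdots x_n$ derive $G\lor G'[M_1/x_1,\dots,M_n/x_n]$. $\beta$-Reduction: from $\neg(\lambda x.L)M\,N_1\cdots N_k\lor G$ derive $\neg L[M/x]N_1\cdots N_k\lor G$. Constraint refutation: from $G\lor\neg\phi_1\lor\cdots\lor\neg\phi_n$ derive $\bot$ if every atom of $G$ has the form $x\,M_1\cdots M_k$ with $x$ a variable, the $\phi_i$ are background atoms, and $\mathcal A,\alpha\models\phi_1\land\cdots\land\phi_n$ for some valuation $\alpha$. $\Gamma'\Rightarrow\Gamma'\cup\{G\}$ if $G$ is derivable by one rule from $\Gamma'$; $\Rightarrow^*$ is the reflexive-transitive closure. -}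

module Defs where

open import Data.Nat using (ℕ)
open import Data.Bool using (Bool; true; false; not; _∧_; _∨_)
open import Data.List using (List; []; _∷_; _++_; map)
open import Data.Maybe using (Maybe; just; nothing)
open import Data.Product using (Σ; _×_; _,_; ∃)
open import Data.Sum using (_⊎_; inj₁; inj₂)
open import Data.Empty using (⊥)
open import Data.Unit using (⊤)
open import Relation.Nullary using (¬_)
open import Relation.Binary.PropositionalEquality using (_≡_)
open import Function.Definitions using (Injective)
open import Data.List.Relation.Unary.All using (All)
open import Data.List.Relation.Unary.Unique.Propositional using (Unique)
open import Data.List.Membership.Propositional using (_∉_)

infixr 7 _⇒_
data Ty : Set where
  ι o : Ty
  _⇒_ : Ty → Ty → Ty

data IsArg : Ty → Set
data IsRel : Ty → Set
data IsArg where
  arg-ι   : IsArg ι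
  arg-rel : ∀ {ρ} → IsRel ρ → IsArg ρ
data IsRel where
  rel-o : IsRel o
  rel-⇒ : ∀ {τ ρ} → IsArg τ → IsRel ρ → IsRel (τ ⇒ ρ)

data IsFO : Ty → Set where
  fo-ι   : IsFO ι
  fo-ι⇒o : IsFO (ι ⇒ o)
  fo-ι⇒  : ∀ {σ} → IsFO σ → IsFO (ι ⇒ σ)

IsType : Ty → Set
IsType σ = IsRel σ ⊎ IsFO σ

-- Variables: the fixed environment Δ.  A variable carries its argument
-- type; Δ(var τ p n) = τ, so Δ⁻¹(τ) is infinite for every argument type.

record Var : Set where
  constructor var
  field
    vty  : Ty
    varg : IsArg vty
    vidx : ℕ
open Var public

record Sig : Set₁ where
  field
    Sym    : Set
    sty    : Sym → Ty
    sty-wf : ∀ c → IsType (sty c)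
open Sig public

FirstOrderSig : Sig → Set
FirstOrderSig S = ∀ c → IsFO (sty S c)

record Ext (S : Sig) : Set₁ where
  field
    NSym : Set
    nty  : NSym → Ty
    nrel : ∀ R → IsRel (nty R)
open Ext public

module _ (S : Sig) (E : Ext S) where
  private
    sty' : Sym S ⊎ NSym E → Ty
    sty' (inj₁ c) = sty S c
    sty' (inj₂ R) = nty E R
    wf' : ∀ c → IsType (sty' c)
    wf' (inj₁ c) = sty-wf S c
    wf' (inj₂ R) = inj₁ (nrel E R)
  extSig : Sig
  extSig = record { Sym = Sym S ⊎ NSym E ; sty = sty' ; sty-wf = wf' }

-- Terms (locally nameless: free variables are named Var's, λ-bound
-- variables are de Bruijn indices into a context of argument types)

data _∋_ : List Ty → Ty → Set where
  here  : ∀ {Γ τ} → (τ ∷ Γ) ∋ τ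
  there : ∀ {Γ τ τ'} → Γ ∋ τ → (τ' ∷ Γ) ∋ τ

module Syntax (S : Sig) where

  data Tm (Γ : List Ty) : Ty → Set where
    fvar : (x : Var) → Tm Γ (vty x)
    bvar : ∀ {τ} → Γ ∋ τ → Tm Γ τ
    con  : (c : Sym S) → Tm Γ (sty S c)
    neg  : Tm Γ o → Tm Γ o
    and  : Tm Γ (o ⇒ o ⇒ o)
    or   : Tm Γ (o ⇒ o ⇒ o)
    ex   : (τ : Ty) → IsArg τ → Tm Γ ((τ ⇒ o) ⇒ o)
    app  : ∀ {σ₁ σ₂} → Tm Γ (σ₁ ⇒ σ₂) → Tm Γ σ₁ → Tm Γ σ₂
    lam  : ∀ {τ ρ} → IsArg τ → IsRel ρ → Tm (τ ∷ Γ) ρ → Tm Γ (τ ⇒ ρ)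

  PosEx : ∀ {Γ σ} → Tm Γ σ → Set
  PosEx (neg M)     = ⊥
  PosEx (app M N)   = PosEx M × PosEx N
  PosEx (lam _ _ M) = PosEx M
  PosEx _           = ⊤

  NoLogic : ∀ {Γ σ} → Tm Γ σ → Set
  NoLogic (neg M)     = ⊥
  NoLogic and         = ⊥
  NoLogic or          = ⊥
  NoLogic (ex _ _)    = ⊥
  NoLogic (app M N)   = NoLogic M × NoLogic N
  NoLogic (lam _ _ M) = NoLogic M
  NoLogic _           = ⊤

  BRen : List Ty → List Ty → Set
  BRen Γ Δ = ∀ {τ} → Γ ∋ τ → Δ ∋ τ

  extR : ∀ {Γ Δ τ} → BRen Γ Δ → BRen (τ ∷ Γ) (τ ∷ Δ)
  extR r here      = here
  extR r (there i) = there (r i)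

  brename : ∀ {Γ Δ σ} → BRen Γ Δ → Tm Γ σ → Tm Δ σ
  brename r (fvar x)      = fvar x
  brename r (bvar i)      = bvar (r i)
  brename r (con c)       = con c
  brename r (neg M)       = neg (brename r M)
  brename r and           = and
  brename r or            = or
  brename r (ex τ p)      = ex τ p
  brename r (app M N)     = app (brename r M) (brename r N)
  brename r (lam a b M)   = lam a b (brename (extR r) M)

  BSub : List Ty → List Ty → Set
  BSub Γ Δ = ∀ {τ} → Γ ∋ τ → Tm Δ τ

  extS : ∀ {Γ Δ τ} → BSub Γ Δ → BSub (τ ∷ Γ) (τ ∷ Δ)
  extS s here      = bvar here
  extS s (there i) = brename there (s i)

  bsubst : ∀ {Γ Δ σ} → BSub Γ Δ → Tm Γ σ → Tm Δ σ
  bsubst s (fvar x)    = fvar x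
  bsubst s (bvar i)    = s i
  bsubst s (con c)     = con c
  bsubst s (neg M)     = neg (bsubst s M)
  bsubst s and         = and
  bsubst s or          = or
  bsubst s (ex τ p)    = ex τ p
  bsubst s (app M N)   = app (bsubst s M) (bsubst s N)
  bsubst s (lam a b M) = lam a b (bsubst (extS s) M)

  inst : ∀ {Γ τ σ} → Tm (τ ∷ Γ) σ → Tm Γ τ → Tm Γ σ
  inst {Γ} {τ} L M = bsubst s L
    where
      s : BSub (τ ∷ Γ) Γ
      s here      = M
      s (there i) = bvar i

  weaken0 : ∀ {Γ σ} → Tm [] σ → Tm Γ σ
  weaken0 = brename (λ ())

  FSub : Set
  FSub = (x : Var) → Tm [] (vty x)

  fsubst : ∀ {Γ σ} → FSub → Tm Γ σ → Tm Γ σ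
  fsubst θ (fvar x)    = weaken0 (θ x)
  fsubst θ (bvar i)    = bvar i
  fsubst θ (con c)     = con c
  fsubst θ (neg M)     = neg (fsubst θ M)
  fsubst θ and         = and
  fsubst θ or          = or
  fsubst θ (ex τ p)    = ex τ p
  fsubst θ (app M N)   = app (fsubst θ M) (fsubst θ N)
  fsubst θ (lam a b M) = lam a b (fsubst θ M)

  VarRen : Set
  VarRen = Ty → ℕ → ℕ

  IsRenaming : VarRen → Set
  IsRenaming π = ∀ τ → Injective _≡_ _≡_ (π τ)

  renVar : VarRen → Var → Var
  renVar π x = var (vty x) (varg x) (π (vty x) (vidx x))

  renTm : ∀ {Γ σ} → VarRen → Tm Γ σ → Tm Γ σ
  renTm π (fvar x)    = fvar (renVar π x)
  renTm π (bvar i)    = bvar i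
  renTm π (con c)     = con c
  renTm π (neg M)     = neg (renTm π M)
  renTm π and         = and
  renTm π or          = or
  renTm π (ex τ p)    = ex τ p
  renTm π (app M N)   = app (renTm π M) (renTm π N)
  renTm π (lam a b M) = lam a b (renTm π M)

-- H⟦ι⟧ is the carrier D of the structure being expanded,
-- H⟦o⟧ = {0,1} = Bool (0 = false, 1 = true), H⟦σ₁→σ₂⟧ = Fun σ₁ σ₂, a set
-- of functions H⟦σ₁⟧ → H⟦σ₂⟧ (given by an injective application map).

El : (D : Set) → (Ty → Ty → Set) → Ty → Set
El D F ι       = D
El D F o       = Bool
El D F (a ⇒ b) = F a b

record PreFrame (D : Set) : Set₁ where
  field
    Fun       : Ty → Ty → Set
    ap        : ∀ {a b} → Fun a b → El D Fun a → El D Fun b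
    ap-inj    : ∀ {a b} (f g : Fun a b) → (∀ x → ap f x ≡ ap g x) → f ≡ g
    nonempty  : ∀ σ → IsType σ → El D Fun σ
    minH      : Fun o (o ⇒ o)
    minH-spec : ∀ x y → ap (ap minH x) y ≡ (x ∧ y)
    maxH      : Fun o (o ⇒ o)
    maxH-spec : ∀ x y → ap (ap maxH x) y ≡ (x ∨ y)
    exH       : ∀ τ → IsArg τ → Fun (τ ⇒ o) o
    exH-spec  : ∀ τ (p : IsArg τ) (r : Fun τ o) →
                  ((ap (exH τ p) r ≡ true) → ∃ λ (s : El D Fun τ) → ap r s ≡ true)
                × ((∃ λ (s : El D Fun τ) → ap r s ≡ true) → ap (exH τ p) r ≡ true)

-- The denotation of λx.M is r ↦ ⟦M⟧(α[x↦r]) if that function lies in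
-- the frame, and arbitrary otherwise (the arbitrary choice is part of
-- the structure).

module Semantics (S : Sig) {D : Set} (H : PreFrame D) where
  open Syntax S
  open PreFrame H

  ⟦_⟧ : Ty → Set
  ⟦ σ ⟧ = El D Fun σ

  Valuation : Set
  Valuation = (x : Var) → ⟦ vty x ⟧

  Env : List Ty → Set
  Env Γ = ∀ τ → Γ ∋ τ → ⟦ τ ⟧

  ε : Env []
  ε _ ()

  _▸_ : ∀ {Γ τ} → Env Γ → ⟦ τ ⟧ → Env (τ ∷ Γ)
  (η ▸ s) _ here      = s
  (η ▸ s) τ (there i) = η τ i

  record Structure : Set where
    field
      interp   : (c : Sym S) → ⟦ sty S c ⟧
      den      : ∀ {Γ σ} → Tm Γ σ → Valuation → Env Γ → ⟦ σ ⟧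
      den-fvar : ∀ {Γ} x α (η : Env Γ) → den (fvar x) α η ≡ α x
      den-bvar : ∀ {Γ τ} (i : Γ ∋ τ) α (η : Env Γ) → den (bvar i) α η ≡ η τ i
      den-con  : ∀ {Γ} c α (η : Env Γ) → den (con c) α η ≡ interp c
      den-neg  : ∀ {Γ} (M : Tm Γ o) α η → den (neg M) α η ≡ not (den M α η)
      den-and  : ∀ {Γ} α (η : Env Γ) → den and α η ≡ minH
      den-or   : ∀ {Γ} α (η : Env Γ) → den or α η ≡ maxH
      den-ex   : ∀ {Γ} τ p α (η : Env Γ) → den (ex τ p) α η ≡ exH τ p
      den-app  : ∀ {Γ σ₁ σ₂} (M : Tm Γ (σ₁ ⇒ σ₂)) (N : Tm Γ σ₁) α η →
                   den (app M N) α η ≡ ap (den M α η) (den N α η)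
      den-lam  : ∀ {Γ τ ρ} (a : IsArg τ) (b : IsRel ρ) (M : Tm (τ ∷ Γ) ρ) α η →
                   (Σ (Fun τ ρ) λ h → ∀ s → ap h s ≡ den M α (η ▸ s)) →
                   ∀ s → ap (den (lam a b M) α η) s ≡ den M α (η ▸ s)
  open Structure public

IsFrame : {D : Set} → PreFrame D → Set₁
IsFrame {D} H =
  ∀ (S : Sig) (B : Semantics.Structure S H) {Γ τ ρ}
    (a : IsArg τ) (b : IsRel ρ) (M : Syntax.Tm S (τ ∷ Γ) ρ) →
    Syntax.PosEx S (Syntax.lam a b M) →
    ∀ α (η : Semantics.Env S H Γ) s →
      PreFrame.ap H (Semantics.den B (Syntax.lam a b M) α η) s
        ≡ Semantics.den B M α (Semantics._▸_ S H η s)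

FOEl : Set → Ty → Set
FOEl D ι       = D
FOEl D o       = Bool
FOEl D (a ⇒ b) = FOEl D a → FOEl D b

record FOStructure (S : Sig) : Set₁ where
  field
    D   : Set
    d₀  : D
    cA  : (c : Sym S) → FOEl D (sty S c)
open FOStructure public

Corr : {D : Set} (H : PreFrame D) (σ : Ty) → El D (PreFrame.Fun H) σ → FOEl D σ → Set
Corr H ι       x y = x ≡ y
Corr H o       x y = x ≡ y
Corr H (a ⇒ b) f g = ∀ x y → Corr H a x y → Corr H b (PreFrame.ap H f x) (g y)

-- H expands A:  H⟦ι⟧ = A⟦ι⟧ (built into PreFrame D) and c^A ∈ H⟦σ⟧
Expands : (S : Sig) (A : FOStructure S) → PreFrame (D A) → Set
Expands S A H = ∀ c → Σ (El (D A) (PreFrame.Fun H) (sty S c)) λ h → Corr H (sty S c) h (cA A c)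

module Clauses (S : Sig) (E : Ext S) (A : FOStructure S) where
  S' : Sig
  S' = extSig S E
  open Syntax S'

  Atom : Set
  Atom = Tm [] o

  IsAtom : Atom → Set
  IsAtom = NoLogic

  data VArgs : Ty → Set where
    vnil  : VArgs o
    vcons : ∀ {ρ} (x : Var) → VArgs ρ → VArgs (vty x ⇒ ρ)

  vars : ∀ {σ} → VArgs σ → List Var
  vars vnil         = []
  vars (vcons x xs) = x ∷ vars xs

  spineV : ∀ {σ} → Tm [] σ → VArgs σ → Tm [] o
  spineV h vnil         = h
  spineV h (vcons x xs) = spineV (app h (fvar x)) xs

  data Args : Ty → Set where
    anil  : Args o
    acons : ∀ {τ ρ} → Tm [] τ → Args ρ → Args (τ ⇒ ρ)

  spineA : ∀ {σ} → Tm [] σ → Args σ → Tm [] o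
  spineA h anil         = h
  spineA h (acons M Ms) = spineA (app h M) Ms

  record Head : Set where
    constructor mkHead
    field
      R  : NSym E
      xs : VArgs (nty E R)

  headTm : Head → Atom
  headTm (mkHead R xs) = spineV (con (inj₂ R)) xs

  -- ¬A₁ ∨ ⋯ ∨ ¬Aₙ  (head = nothing)  or  ¬A₁ ∨ ⋯ ∨ ¬Aₙ ∨ R x̄  (head = just _)
  record Clause : Set where
    constructor mkClause
    field
      body : List Atom
      head : Maybe Head
  open Clause public

  ⊥clause : Clause
  ⊥clause = mkClause [] nothing

  IsGoalClause : Clause → Set
  IsGoalClause C = All IsAtom (body C) × head C ≡ nothing

  IsDefiniteClause : Clause → Set
  IsDefiniteClause C =
    All IsAtom (body C) × Σ Head λ h → head C ≡ just h × Unique (vars (Head.xs h))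

  IsHoCHC : Clause → Set
  IsHoCHC C = IsGoalClause C ⊎ IsDefiniteClause C

  renVArgs : ∀ {σ} → VarRen → VArgs σ → VArgs σ
  renVArgs π vnil         = vnil
  renVArgs π (vcons x xs) = vcons (renVar π x) (renVArgs π xs)

  renHead : VarRen → Maybe Head → Maybe Head
  renHead π nothing              = nothing
  renHead π (just (mkHead R xs)) = just (mkHead R (renVArgs π xs))

  renClause : VarRen → Clause → Clause
  renClause π (mkClause G h) = mkClause (map (renTm π) G) (renHead π h)

  Agree : ∀ {σ} → FSub → VArgs σ → Args σ → Set
  Agree θ vnil         anil         = ⊤
  Agree θ (vcons x xs) (acons M Ms) = (θ x ≡ M) × Agree θ xs Ms

  data IsBG : ∀ {σ} → Tm [] σ → Set where
    bg-con : (c : Sym S) → IsBG (con (inj₁ c))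
    bg-var : (n : ℕ) → IsBG (fvar (var ι arg-ι n))
    bg-app : ∀ {σ₁ σ₂} {M : Tm [] (σ₁ ⇒ σ₂)} {N : Tm [] σ₁} →
             IsBG M → IsBG N → IsBG (app M N)

  evalBG : ∀ {σ} {M : Tm [] σ} → (ℕ → D A) → IsBG M → FOEl (D A) σ
  evalBG α (bg-con c)   = cA A c
  evalBG α (bg-var n)   = α n
  evalBG α (bg-app p q) = evalBG α p (evalBG α q)

  data Flex : ∀ {σ} → Tm [] σ → Set where
    flex-var : (x : Var) → Flex (fvar x)
    flex-app : ∀ {σ₁ σ₂} {M : Tm [] (σ₁ ⇒ σ₂)} {N : Tm [] σ₁} → Flex M → Flex (app M N)

  data BetaHead : ∀ {σ} → Tm [] σ → Tm [] σ → Set where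
    bh-here : ∀ {τ ρ} (a : IsArg τ) (b : IsRel ρ) (L : Tm (τ ∷ []) ρ) (M : Tm [] τ) →
              BetaHead (app (lam a b L) M) (inst L M)
    bh-app  : ∀ {σ₁ σ₂} {P P' : Tm [] (σ₁ ⇒ σ₂)} (N : Tm [] σ₁) →
              BetaHead P P' → BetaHead (app P N) (app P' N)

  -- one inference step, premises taken modulo renaming of free variables
  data Step (Δ : Clause → Set) : Clause → Set where
    resolution :
      ∀ {C₁ C₂ : Clause} (π₁ π₂ : VarRen) → IsRenaming π₁ → IsRenaming π₂ →
      Δ C₁ → Δ C₂ →
      (G₁ G₂ G' : List Atom) (R : NSym E) (Ms : Args (nty E R)) (xs : VArgs (nty E R)) →
      renClause π₁ C₁ ≡ mkClause (G₁ ++ spineA (con (inj₂ R)) Ms ∷ G₂) nothing →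
      renClause π₂ C₂ ≡ mkClause G' (just (mkHead R xs)) →
      (θ : FSub) → Agree θ xs Ms → (∀ y → y ∉ vars xs → θ y ≡ fvar y) →
      Step Δ (mkClause (G₁ ++ G₂ ++ map (fsubst θ) G') nothing)
    beta :
      ∀ {C : Clause} (π : VarRen) → IsRenaming π → Δ C →
      (G₁ G₂ : List Atom) (P P' : Atom) →
      renClause π C ≡ mkClause (G₁ ++ P ∷ G₂) nothing →
      BetaHead P P' →
      Step Δ (mkClause (G₁ ++ P' ∷ G₂) nothing)
    constraint-refutation :
      ∀ {C : Clause} (π : VarRen) → IsRenaming π → Δ C →
      (G : List Atom) → renClause π C ≡ mkClause G nothing →
      All (λ P → Flex P ⊎ IsBG P) G →
      (Σ (ℕ → D A) λ α → All (λ P → (b : IsBG P) → evalBG α b ≡ true) G) →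
      Step Δ ⊥clause

  _∪｛_｝ : (Clause → Set) → Clause → (Clause → Set)
  (Δ ∪｛ G ｝) C = Δ C ⊎ C ≡ G

  data _⇒*_ (Γ : Clause → Set) : (Clause → Set) → Set₁ where
    ⇒*-refl : Γ ⇒* Γ
    ⇒*-step : ∀ {Δ G} → Γ ⇒* Δ → Step Δ G → Γ ⇒* (Δ ∪｛ G ｝)

  module _ (H : PreFrame (D A)) where
    open Semantics S' H

    headVal : Structure → Valuation → Maybe Head → Bool
    headVal B α nothing  = false
    headVal B α (just h) = den B (headTm h) α ε

    litsVal : Structure → Valuation → List Atom → Bool → Bool
    litsVal B α []      b = b
    litsVal B α (P ∷ G) b = not (den B P α ε) ∨ litsVal B α G b

    _⊨_ : Structure → Clause → Set
    B ⊨ C = ∀ α → litsVal B α (body C) (headVal B α (head C)) ≡ true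

    IsExpansion : Structure → Set
    IsExpansion B = ∀ c → Corr H (sty S c) (interp B (inj₁ c)) (cA A c)

    Satisfiable : (Clause → Set) → Set
    Satisfiable Γ = Σ Structure λ B → IsExpansion B × (∀ C → Γ C → B ⊨ C)

-- Soundness by an invariant: in a model B of Γ that expands A, every derived
-- clause is true in B and its negative atoms are positive existential.  For
-- positive existential terms the frame condition yields the substitution
-- lemmas, so resolution and β-reduction preserve truth.  The premise of a
-- constraint refutation is false under the valuation sending ι-variables to
-- the witnessing assignment and every relational variable to the full
-- relation λx̄. ∃b. b, which any frame contains; hence ⊥ is never derived.
module Submission where

open import Defs
open import Data.Bool using (Bool; true; false; not; _∨_)
open import Data.Bool.Properties using (∨-assoc)
open import Data.List using (List; []; _∷_; _++_; map)
open import Data.List.Membership.Propositional using (_∈_; _∉_)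
open import Data.List.Relation.Unary.All as All using (All; []; _∷_)
import Data.List.Relation.Unary.All.Properties as AllP
open import Data.List.Relation.Unary.Any using (here; there)
open import Data.Maybe using (Maybe; just; nothing)
open import Data.Nat using (ℕ)
open import Data.Product using (Σ; _×_; _,_; proj₁; proj₂)
open import Data.Sum using (_⊎_; inj₁; inj₂; [_,_]′)
open import Data.Unit using (⊤; tt)
open import Relation.Nullary using (¬_; Dec; yes; no; contradiction)
open import Relation.Binary.PropositionalEquality
  using (_≡_; refl; sym; trans; cong; cong₂; subst; module ≡-Reasoning)

module PositiveExistential (S : Sig) where
  open Syntax S

  posEx? : ∀ {Γ σ} (M : Tm Γ σ) → Dec (PosEx M)
  posEx? (fvar x)    = yes tt
  posEx? (bvar i)    = yes tt
  posEx? (con c)     = yes tt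
  posEx? (neg M)     = no λ ()
  posEx? and         = yes tt
  posEx? or          = yes tt
  posEx? (ex τ p)    = yes tt
  posEx? (lam a b M) = posEx? M
  posEx? (app M N) with posEx? M | posEx? N
  ... | yes p | yes q = yes (p , q)
  ... | no ¬p | _     = no λ pq → ¬p (proj₁ pq)
  ... | yes _ | no ¬q = no λ pq → ¬q (proj₂ pq)

  noLogic⇒posEx : ∀ {Γ σ} (M : Tm Γ σ) → NoLogic M → PosEx M
  noLogic⇒posEx (fvar x)    _       = tt
  noLogic⇒posEx (bvar i)    _       = tt
  noLogic⇒posEx (con c)     _       = tt
  noLogic⇒posEx (app M N)   (p , q) = noLogic⇒posEx M p , noLogic⇒posEx N q
  noLogic⇒posEx (lam a b M) p       = noLogic⇒posEx M p

  brename-posEx : ∀ {Γ Δ σ} (r : BRen Γ Δ) (M : Tm Γ σ) → PosEx M → PosEx (brename r M)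
  brename-posEx r (fvar x)    _       = tt
  brename-posEx r (bvar i)    _       = tt
  brename-posEx r (con c)     _       = tt
  brename-posEx r and         _       = tt
  brename-posEx r or          _       = tt
  brename-posEx r (ex τ q)    _       = tt
  brename-posEx r (app M N)   (p , q) = brename-posEx r M p , brename-posEx r N q
  brename-posEx r (lam a b M) p       = brename-posEx (extR r) M p

  PosExSub : ∀ {Γ Δ} → BSub Γ Δ → Set
  PosExSub {Γ} s = ∀ {τ} (i : Γ ∋ τ) → PosEx (s i)

  extS-posEx : ∀ {Γ Δ τ} {s : BSub Γ Δ} → PosExSub s → PosExSub (extS {τ = τ} s)
  extS-posEx         ps here      = tt
  extS-posEx {s = s} ps (there i) = brename-posEx there (s i) (ps i)

  bsubst-posEx : ∀ {Γ Δ σ} {s : BSub Γ Δ} → PosExSub s → (M : Tm Γ σ) → PosEx M → PosEx (bsubst s M)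
  bsubst-posEx ps (fvar x)    _       = tt
  bsubst-posEx ps (bvar i)    _       = ps i
  bsubst-posEx ps (con c)     _       = tt
  bsubst-posEx ps and         _       = tt
  bsubst-posEx ps or          _       = tt
  bsubst-posEx ps (ex τ q)    _       = tt
  bsubst-posEx ps (app M N)   (p , q) = bsubst-posEx ps M p , bsubst-posEx ps N q
  bsubst-posEx ps (lam a b M) p       = bsubst-posEx (extS-posEx ps) M p

  inst-posEx : ∀ {Γ τ σ} (L : Tm (τ ∷ Γ) σ) {M : Tm Γ τ} → PosEx L → PosEx M → PosEx (inst L M)
  inst-posEx L pL pM = bsubst-posEx (λ { here → pM ; (there i) → tt }) L pL

  fsubst-posEx : ∀ {Γ σ} (θ : FSub) → (∀ x → PosEx (θ x)) → (M : Tm Γ σ) → PosEx M → PosEx (fsubst θ M)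
  fsubst-posEx θ pθ (fvar x)    _       = brename-posEx (λ ()) (θ x) (pθ x)
  fsubst-posEx θ pθ (bvar i)    _       = tt
  fsubst-posEx θ pθ (con c)     _       = tt
  fsubst-posEx θ pθ and         _       = tt
  fsubst-posEx θ pθ or          _       = tt
  fsubst-posEx θ pθ (ex τ q)    _       = tt
  fsubst-posEx θ pθ (app M N)   (p , q) = fsubst-posEx θ pθ M p , fsubst-posEx θ pθ N q
  fsubst-posEx θ pθ (lam a b M) p       = fsubst-posEx θ pθ M p

  renameSub : VarRen → FSub
  renameSub π x = fvar (renVar π x)

  renTm≡fsubst : ∀ {Γ σ} π (M : Tm Γ σ) → renTm π M ≡ fsubst (renameSub π) M
  renTm≡fsubst π (fvar x)    = refl
  renTm≡fsubst π (bvar i)    = refl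
  renTm≡fsubst π (con c)     = refl
  renTm≡fsubst π (neg M)     = cong neg (renTm≡fsubst π M)
  renTm≡fsubst π and         = refl
  renTm≡fsubst π or          = refl
  renTm≡fsubst π (ex τ p)    = refl
  renTm≡fsubst π (app M N)   = cong₂ app (renTm≡fsubst π M) (renTm≡fsubst π N)
  renTm≡fsubst π (lam a b M) = cong (lam a b) (renTm≡fsubst π M)

  renTm-posEx : ∀ {Γ σ} π (M : Tm Γ σ) → PosEx M → PosEx (renTm π M)
  renTm-posEx π M p = subst PosEx (sym (renTm≡fsubst π M)) (fsubst-posEx (renameSub π) (λ _ → tt) M p)

module FrameSemantics (S : Sig) {Dom : Set} (H : PreFrame Dom) (frame : IsFrame H)
                      (B : Semantics.Structure S H) where
  open Syntax S
  open Semantics S H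
  open PreFrame H
  open PositiveExistential S
  open ≡-Reasoning

  den-app-cong : ∀ {Γ Γ' σ₁ σ₂} {M : Tm Γ (σ₁ ⇒ σ₂)} {N : Tm Γ σ₁} {M' : Tm Γ' (σ₁ ⇒ σ₂)} {N' : Tm Γ' σ₁}
                   {α α' η η'} →
                 den B M α η ≡ den B M' α' η' → den B N α η ≡ den B N' α' η' →
                 den B (app M N) α η ≡ den B (app M' N') α' η'
  den-app-cong {M = M} {N} {M'} {N'} {α} {α'} {η} {η'} eM eN =
    trans (den-app B M N α η) (trans (cong₂ ap eM eN) (sym (den-app B M' N' α' η')))

  -- The frame condition only covers positive existential bodies, hence the
  -- PosEx bookkeeping throughout.
  den-lam-ext : ∀ {Γ Γ' τ ρ} (a : IsArg τ) (b : IsRel ρ) {M : Tm (τ ∷ Γ) ρ} {M' : Tm (τ ∷ Γ') ρ}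
                  {α α' η η'} → PosEx M → PosEx M' →
                (∀ s → den B M α (η ▸ s) ≡ den B M' α' (η' ▸ s)) →
                den B (lam a b M) α η ≡ den B (lam a b M') α' η'
  den-lam-ext a b {M} {M'} {α} {α'} {η} {η'} p p' e = ap-inj _ _ λ s → begin
    ap (den B (lam a b M) α η) s     ≡⟨ frame S B a b M p α η s ⟩
    den B M α (η ▸ s)                ≡⟨ e s ⟩
    den B M' α' (η' ▸ s)             ≡⟨ frame S B a b M' p' α' η' s ⟨
    ap (den B (lam a b M') α' η') s  ∎

  den-brename : ∀ {Γ Δ σ} (r : BRen Γ Δ) (M : Tm Γ σ) → PosEx M →
                ∀ α (η : Env Γ) (η' : Env Δ) → (∀ τ (i : Γ ∋ τ) → η' τ (r i) ≡ η τ i) →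
                den B (brename r M) α η' ≡ den B M α η
  den-brename r (fvar x)    _       α η η' h = trans (den-fvar B x α η') (sym (den-fvar B x α η))
  den-brename r (bvar i)    _       α η η' h =
    trans (den-bvar B (r i) α η') (trans (h _ i) (sym (den-bvar B i α η)))
  den-brename r (con c)     _       α η η' h = trans (den-con B c α η') (sym (den-con B c α η))
  den-brename r and         _       α η η' h = trans (den-and B α η') (sym (den-and B α η))
  den-brename r or          _       α η η' h = trans (den-or B α η') (sym (den-or B α η))
  den-brename r (ex τ q)    _       α η η' h = trans (den-ex B τ q α η') (sym (den-ex B τ q α η))
  den-brename r (app M N)   (p , q) α η η' h =
    den-app-cong (den-brename r M p α η η' h) (den-brename r N q α η η' h)
  den-brename r (lam a b M) p       α η η' h =
    den-lam-ext a b (brename-posEx (extR r) M p) p λ s → den-brename (extR r) M p α (η ▸ s) (η' ▸ s) (h▸ s)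
    where
      h▸ : ∀ s τ (i : _ ∋ τ) → (η' ▸ s) τ (extR r i) ≡ (η ▸ s) τ i
      h▸ s _ here      = refl
      h▸ s τ (there i) = h τ i

  den-weaken0 : ∀ {Γ σ} (N : Tm [] σ) → PosEx N → ∀ α (η : Env Γ) → den B (weaken0 N) α η ≡ den B N α ε
  den-weaken0 N p α η = den-brename (λ ()) N p α ε η λ _ ()

  den-bsubst : ∀ {Γ Δ σ} {s : BSub Γ Δ} → PosExSub s → (M : Tm Γ σ) → PosEx M →
               ∀ α (η : Env Δ) (η' : Env Γ) → (∀ τ (i : Γ ∋ τ) → den B (s i) α η ≡ η' τ i) →
               den B (bsubst s M) α η ≡ den B M α η'
  den-bsubst ps (fvar x)    _       α η η' h = trans (den-fvar B x α η) (sym (den-fvar B x α η'))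
  den-bsubst ps (bvar i)    _       α η η' h = trans (h _ i) (sym (den-bvar B i α η'))
  den-bsubst ps (con c)     _       α η η' h = trans (den-con B c α η) (sym (den-con B c α η'))
  den-bsubst ps and         _       α η η' h = trans (den-and B α η) (sym (den-and B α η'))
  den-bsubst ps or          _       α η η' h = trans (den-or B α η) (sym (den-or B α η'))
  den-bsubst ps (ex τ q)    _       α η η' h = trans (den-ex B τ q α η) (sym (den-ex B τ q α η'))
  den-bsubst ps (app M N)   (p , q) α η η' h =
    den-app-cong (den-bsubst ps M p α η η' h) (den-bsubst ps N q α η η' h)
  den-bsubst {s = s} ps (lam a b M) p α η η' h =
    den-lam-ext a b (bsubst-posEx (extS-posEx ps) M p) p λ x →
      den-bsubst (extS-posEx ps) M p α (η ▸ x) (η' ▸ x) (h▸ x)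
    where
      h▸ : ∀ x τ (i : _ ∋ τ) → den B (extS s i) α (η ▸ x) ≡ (η' ▸ x) τ i
      h▸ x _ here      = den-bvar B here α (η ▸ x)
      h▸ x τ (there i) = trans (den-brename there (s i) (ps i) α η (η ▸ x) λ _ _ → refl) (h τ i)

  den-inst : ∀ {Γ τ σ} (L : Tm (τ ∷ Γ) σ) (M : Tm Γ τ) → PosEx L → PosEx M →
             ∀ α (η : Env Γ) → den B (inst L M) α η ≡ den B L α (η ▸ den B M α η)
  den-inst L M pL pM α η = den-bsubst (λ { here → pM ; (there i) → tt }) L pL α η (η ▸ den B M α η) λ
    { _ here      → refl
    ; _ (there i) → den-bvar B i α η }

  den-fsubst : ∀ {Γ σ} (θ : FSub) → (∀ x → PosEx (θ x)) → (M : Tm Γ σ) → PosEx M →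
               ∀ α (α' : Valuation) (η : Env Γ) → (∀ x → den B (θ x) α ε ≡ α' x) →
               den B (fsubst θ M) α η ≡ den B M α' η
  den-fsubst θ pθ (fvar x)    _       α α' η h =
    trans (den-weaken0 (θ x) (pθ x) α η) (trans (h x) (sym (den-fvar B x α' η)))
  den-fsubst θ pθ (bvar i)    _       α α' η h = trans (den-bvar B i α η) (sym (den-bvar B i α' η))
  den-fsubst θ pθ (con c)     _       α α' η h = trans (den-con B c α η) (sym (den-con B c α' η))
  den-fsubst θ pθ and         _       α α' η h = trans (den-and B α η) (sym (den-and B α' η))
  den-fsubst θ pθ or          _       α α' η h = trans (den-or B α η) (sym (den-or B α' η))
  den-fsubst θ pθ (ex τ q)    _       α α' η h = trans (den-ex B τ q α η) (sym (den-ex B τ q α' η))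
  den-fsubst θ pθ (app M N)   (p , q) α α' η h =
    den-app-cong (den-fsubst θ pθ M p α α' η h) (den-fsubst θ pθ N q α α' η h)
  den-fsubst θ pθ (lam a b M) p       α α' η h =
    den-lam-ext a b (fsubst-posEx θ pθ M p) p λ x → den-fsubst θ pθ M p α α' (η ▸ x) h

  den-renTm : ∀ {Γ σ} π (M : Tm Γ σ) → PosEx M → ∀ α (η : Env Γ) →
              den B (renTm π M) α η ≡ den B M (λ x → α (renVar π x)) η
  den-renTm π M p α η = begin
    den B (renTm π M) α η                    ≡⟨ cong (λ N → den B N α η) (renTm≡fsubst π M) ⟩
    den B (fsubst (renameSub π) M) α η       ≡⟨ den-fsubst (renameSub π) (λ _ → tt) M p α _ η
                                                  (λ x → den-fvar B (renVar π x) α ε) ⟩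
    den B M (λ x → α (renVar π x)) η         ∎

module Soundness (S : Sig) (E : Ext S) (A : FOStructure S) (H : PreFrame (D A)) (frame : IsFrame H)
                 (B : Semantics.Structure (extSig S E) H) where
  open Clauses S E A
  open Syntax S'
  open Semantics S' H
  open PreFrame H
  open PositiveExistential S'
  open FrameSemantics S' H frame B
  open ≡-Reasoning

  lits : Valuation → List Atom → Bool → Bool
  lits = litsVal H B

  lits-++ : ∀ α G G' b → lits α (G ++ G') b ≡ lits α G false ∨ lits α G' b
  lits-++ α []      G' b = refl
  lits-++ α (P ∷ G) G' b =
    trans (cong (not (den B P α ε) ∨_) (lits-++ α G G' b)) (sym (∨-assoc (not (den B P α ε)) _ _))

  lits-∨ : ∀ α G b → lits α G b ≡ lits α G false ∨ b
  lits-∨ α []      b = refl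
  lits-∨ α (P ∷ G) b =
    trans (cong (not (den B P α ε) ∨_) (lits-∨ α G b)) (sym (∨-assoc (not (den B P α ε)) _ b))

  lits-map : ∀ α α' (f : Atom → Atom) G b → All (λ P → den B (f P) α ε ≡ den B P α' ε) G →
             lits α (map f G) b ≡ lits α' G b
  lits-map α α' f []      b []       = refl
  lits-map α α' f (P ∷ G) b (e ∷ es) = cong₂ (λ u v → not u ∨ v) e (lits-map α α' f G b es)

  Valid : Clause → Set
  Valid C = All PosEx (body C) × _⊨_ H B C

  hoCHC-valid : ∀ C → IsHoCHC C → _⊨_ H B C → Valid C
  hoCHC-valid C hochc B⊨C = All.map (λ {P} → noLogic⇒posEx P) ([ proj₁ , proj₁ ]′ hochc) , B⊨C

  spineV-posEx : ∀ {σ} {h : Tm [] σ} (xs : VArgs σ) → PosEx h → PosEx (spineV h xs)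
  spineV-posEx vnil         p = p
  spineV-posEx (vcons x xs) p = spineV-posEx xs (p , tt)

  renTm-spineV : ∀ {σ} π (h : Tm [] σ) (xs : VArgs σ) →
                 renTm π (spineV h xs) ≡ spineV (renTm π h) (renVArgs π xs)
  renTm-spineV π h vnil         = refl
  renTm-spineV π h (vcons x xs) = renTm-spineV π (app h (fvar x)) xs

  headVal-renHead : ∀ π α (h : Maybe Head) →
                    headVal H B α (renHead π h) ≡ headVal H B (λ x → α (renVar π x)) h
  headVal-renHead π α nothing                = refl
  headVal-renHead π α (just (mkHead R xs)) =
    trans (cong (λ t → den B t α ε) (sym (renTm-spineV π (con (inj₂ R)) xs)))
          (den-renTm π _ (spineV-posEx xs tt) α ε)

  renClause-valid : ∀ π C → Valid C → Valid (renClause π C)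
  renClause-valid π (mkClause G h) (pG , B⊨C) =
    AllP.map⁺ (All.map (λ {P} → renTm-posEx π P) pG) , λ α → begin
      lits α (map (renTm π) G) (headVal H B α (renHead π h))
        ≡⟨ lits-map α (απ α) (renTm π) G _ (All.map (λ {P} p → den-renTm π P p α ε) pG) ⟩
      lits (απ α) G (headVal H B α (renHead π h))
        ≡⟨ cong (lits (απ α) G) (headVal-renHead π α h) ⟩
      lits (απ α) G (headVal H B (απ α) h)
        ≡⟨ B⊨C (απ α) ⟩
      true ∎
    where
      απ : Valuation → Valuation
      απ α x = α (renVar π x)

  renamed-valid : ∀ {C C'} π → Valid C → renClause π C ≡ C' → Valid C'
  renamed-valid {C} π v e = subst Valid e (renClause-valid π C v)

  substVal : FSub → Valuation → Valuation
  substVal θ α x = den B (θ x) α ε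

  spineA-head-posEx : ∀ {σ} {h : Tm [] σ} (Ms : Args σ) → PosEx (spineA h Ms) → PosEx h
  spineA-head-posEx anil         p = p
  spineA-head-posEx (acons M Ms) p = proj₁ (spineA-head-posEx Ms p)

  agree-posEx : ∀ {σ θ} {h : Tm [] σ} {xs : VArgs σ} {Ms : Args σ} → Agree θ xs Ms →
                PosEx (spineA h Ms) → ∀ {y} → y ∈ vars xs → PosEx (θ y)
  agree-posEx {xs = vcons x xs} {acons M Ms} (θx≡M , _) p (here refl) =
    subst PosEx (sym θx≡M) (proj₂ (spineA-head-posEx Ms p))
  agree-posEx {xs = vcons x xs} {acons M Ms} (_ , ag) p (there y∈xs) = agree-posEx ag p y∈xs

  -- Deciding PosEx sidesteps deciding y ∈ vars xs, as Var has no decidable equality.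
  unifier-posEx : ∀ {σ θ} {h : Tm [] σ} {xs : VArgs σ} {Ms : Args σ} → Agree θ xs Ms →
                  PosEx (spineA h Ms) → (∀ y → y ∉ vars xs → θ y ≡ fvar y) → ∀ y → PosEx (θ y)
  unifier-posEx {θ = θ} ag p fixed y with posEx? (θ y)
  ... | yes q = q
  ... | no ¬q = contradiction (subst PosEx (sym (fixed y λ y∈xs → ¬q (agree-posEx ag p y∈xs))) tt) ¬q

  den-spine : ∀ {σ} θ α {h h' : Tm [] σ} (xs : VArgs σ) (Ms : Args σ) → Agree θ xs Ms →
              den B h (substVal θ α) ε ≡ den B h' α ε →
              den B (spineV h xs) (substVal θ α) ε ≡ den B (spineA h' Ms) α ε
  den-spine θ α vnil         anil         _            e = e
  den-spine θ α (vcons x xs) (acons M Ms) (θx≡M , ag) e =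
    den-spine θ α xs Ms ag (den-app-cong e (trans (den-fvar B x _ ε) (cong (λ t → den B t α ε) θx≡M)))

  resolve : ∀ x y z a → x ∨ (not a ∨ y) ≡ true → z ∨ a ≡ true → x ∨ (y ∨ z) ≡ true
  resolve true  _     _     _     _  _  = refl
  resolve false true  _     _     _  _  = refl
  resolve false false true  _     _  _  = refl
  resolve false false false true  () _
  resolve false false false false _  ()

  resolution-valid :
    ∀ (G₁ G₂ G' : List Atom) (R : NSym E) (Ms : Args (nty E R)) (xs : VArgs (nty E R)) (θ : FSub) →
    Valid (mkClause (G₁ ++ spineA (con (inj₂ R)) Ms ∷ G₂) nothing) →
    Valid (mkClause G' (just (mkHead R xs))) →
    Agree θ xs Ms → (∀ y → y ∉ vars xs → θ y ≡ fvar y) →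
    Valid (mkClause (G₁ ++ G₂ ++ map (fsubst θ) G') nothing)
  resolution-valid G₁ G₂ G' R Ms xs θ (pG , B⊨C₁) (pG' , B⊨C₂) ag fixed =
    AllP.++⁺ pG₁ (AllP.++⁺ pG₂ (AllP.map⁺ (All.map (λ {P} → fsubst-posEx θ pθ P) pG'))) , λ α →
      begin
        lits α (G₁ ++ G₂ ++ θG') false
          ≡⟨ lits-++ α G₁ _ false ⟩
        lits α G₁ false ∨ lits α (G₂ ++ θG') false
          ≡⟨ cong (lits α G₁ false ∨_) (lits-++ α G₂ θG' false) ⟩
        lits α G₁ false ∨ (lits α G₂ false ∨ lits α θG' false)
          ≡⟨ resolve (lits α G₁ false) (lits α G₂ false) (lits α θG' false) (den B RMs α ε)
               (trans (sym (lits-++ α G₁ (RMs ∷ G₂) false)) (B⊨C₁ α)) (instance-valid α) ⟩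
        true ∎
    where
      RMs = spineA (con (inj₂ R)) Ms
      θG' = map (fsubst θ) G'
      split = AllP.++⁻ G₁ pG
      pG₁ = proj₁ split
      pG₂ = All.tail (proj₂ split)
      pθ = unifier-posEx ag (All.head (proj₂ split)) fixed

      instance-valid : ∀ α → lits α θG' false ∨ den B RMs α ε ≡ true
      instance-valid α = begin
        lits α θG' false ∨ den B RMs α ε
          ≡⟨ lits-∨ α θG' _ ⟨
        lits α θG' (den B RMs α ε)
          ≡⟨ lits-map α (substVal θ α) (fsubst θ) G' _
               (All.map (λ {P} p → den-fsubst θ pθ P p α _ ε λ _ → refl) pG') ⟩
        lits (substVal θ α) G' (den B RMs α ε)
          ≡⟨ cong (lits (substVal θ α) G')
               (den-spine θ α xs Ms ag (trans (den-con B _ _ ε) (sym (den-con B _ α ε)))) ⟨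
        lits (substVal θ α) G' (headVal H B (substVal θ α) (just (mkHead R xs)))
          ≡⟨ B⊨C₂ (substVal θ α) ⟩
        true ∎

  betaHead-posEx : ∀ {σ} {P P' : Tm [] σ} → BetaHead P P' → PosEx P → PosEx P'
  betaHead-posEx (bh-here a b L M) (pL , pM) = inst-posEx L pL pM
  betaHead-posEx (bh-app N bh)     (p , q)   = betaHead-posEx bh p , q

  den-betaHead : ∀ {σ} {P P' : Tm [] σ} → BetaHead P P' → PosEx P → ∀ α → den B P' α ε ≡ den B P α ε
  den-betaHead (bh-here a b L M) (pL , pM) α = begin
    den B (inst L M) α ε                       ≡⟨ den-inst L M pL pM α ε ⟩
    den B L α (ε ▸ den B M α ε)                ≡⟨ frame S' B a b L pL α ε _ ⟨
    ap (den B (lam a b L) α ε) (den B M α ε)   ≡⟨ den-app B _ M α ε ⟨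
    den B (app (lam a b L) M) α ε              ∎
  den-betaHead (bh-app N bh) (p , _) α = den-app-cong (den-betaHead bh p α) refl

  beta-valid : ∀ G₁ G₂ {P P' : Atom} → BetaHead P P' →
               Valid (mkClause (G₁ ++ P ∷ G₂) nothing) → Valid (mkClause (G₁ ++ P' ∷ G₂) nothing)
  beta-valid G₁ G₂ {P} {P'} bh (pG , B⊨C) =
    AllP.++⁺ (proj₁ split) (betaHead-posEx bh pP ∷ All.tail (proj₂ split)) , λ α → begin
      lits α (G₁ ++ P' ∷ G₂) false
        ≡⟨ lits-++ α G₁ (P' ∷ G₂) false ⟩
      lits α G₁ false ∨ (not (den B P' α ε) ∨ lits α G₂ false)
        ≡⟨ cong (λ v → lits α G₁ false ∨ (not v ∨ lits α G₂ false)) (den-betaHead bh pP α) ⟩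
      lits α G₁ false ∨ (not (den B P α ε) ∨ lits α G₂ false)
        ≡⟨ lits-++ α G₁ (P ∷ G₂) false ⟨
      lits α (G₁ ++ P ∷ G₂) false
        ≡⟨ B⊨C α ⟩
      true ∎
    where
      split = AllP.++⁻ G₁ pG
      pP = All.head (proj₂ split)

  IsTop : (σ : Ty) → ⟦ σ ⟧ → Set
  IsTop ι       _ = ⊤
  IsTop o       b = b ≡ true
  IsTop (a ⇒ b) f = ∀ s → IsTop b (ap f s)

  topTm : ∀ {Γ ρ} → IsRel ρ → Tm Γ ρ
  topTm rel-o       = app (ex o (arg-rel rel-o)) (lam (arg-rel rel-o) rel-o (bvar here))
  topTm (rel-⇒ a r) = lam a r (topTm r)

  topTm-posEx : ∀ {Γ ρ} (r : IsRel ρ) → PosEx (topTm {Γ} r)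
  topTm-posEx rel-o       = tt , tt
  topTm-posEx (rel-⇒ a r) = topTm-posEx r

  den-topTm : ∀ {Γ ρ} (r : IsRel ρ) α (η : Env Γ) → IsTop ρ (den B (topTm r) α η)
  den-topTm rel-o α η = begin
    den B (app ∃o idₒ) α η           ≡⟨ den-app B ∃o idₒ α η ⟩
    ap (den B ∃o α η) (den B idₒ α η) ≡⟨ cong (λ e → ap e (den B idₒ α η)) (den-ex B o (arg-rel rel-o) α η) ⟩
    ap (exH o _) (den B idₒ α η)      ≡⟨ proj₂ (exH-spec o _ _) (true , idₒ-true) ⟩
    true                              ∎
    where
      ∃o = ex o (arg-rel rel-o)
      idₒ = lam (arg-rel rel-o) rel-o (bvar here)
      idₒ-true : ap (den B idₒ α η) true ≡ true
      idₒ-true = trans (frame S' B _ _ (bvar here) tt α η true) (den-bvar B here α (η ▸ true))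
  den-topTm (rel-⇒ {ρ = ρ} a r) α η s =
    subst (IsTop ρ) (sym (frame S' B a r (topTm r) (topTm-posEx r) α η s)) (den-topTm r α (η ▸ s))

  someValuation : Valuation
  someValuation (var _ arg-ι       _) = nonempty ι (inj₂ fo-ι)
  someValuation (var _ (arg-rel r) _) = nonempty _ (inj₁ r)

  topValuation : (ℕ → D A) → Valuation
  topValuation β (var _ arg-ι       n) = β n
  topValuation β (var _ (arg-rel r) _) = den B (topTm r) someValuation ε

  flex-top : ∀ β {σ} {M : Tm [] σ} → Flex M → IsTop σ (den B M (topValuation β) ε)
  flex-top β (flex-var (var _ arg-ι _))       = tt
  flex-top β (flex-var (var τ (arg-rel r) n)) =
    subst (IsTop τ) (sym (den-fvar B _ _ ε)) (den-topTm r someValuation ε)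
  flex-top β (flex-app {σ₂ = σ₂} {N = N} f) =
    subst (IsTop σ₂) (sym (den-app B _ N _ ε)) (flex-top β f (den B N _ ε))

  background-corr : IsExpansion H B → ∀ β {σ} {M : Tm [] σ} (b : IsBG M) →
                    Corr H σ (den B M (topValuation β) ε) (evalBG β b)
  background-corr expansion β (bg-con c) =
    subst (λ z → Corr H (sty S c) z (cA A c)) (sym (den-con B _ _ ε)) (expansion c)
  background-corr expansion β (bg-var n) = den-fvar B _ _ ε
  background-corr expansion β (bg-app {σ₂ = σ₂} {M = M} {N = N} p q) =
    subst (λ z → Corr H σ₂ z _) (sym (den-app B M N _ ε))
      (background-corr expansion β p _ _ (background-corr expansion β q))

  constraint-falsified : IsExpansion H B → ∀ β (G : List Atom) → All (λ P → Flex P ⊎ IsBG P) G →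
                         All (λ P → (b : IsBG P) → evalBG β b ≡ true) G → lits (topValuation β) G false ≡ false
  constraint-falsified expansion β []      []         []       = refl
  constraint-falsified expansion β (P ∷ G) (fb ∷ fbs) (h ∷ hs) =
    cong₂ (λ u v → not u ∨ v) P-true (constraint-falsified expansion β G fbs hs)
    where
      P-true : den B P (topValuation β) ε ≡ true
      P-true = [ flex-top β , (λ b → trans (background-corr expansion β b) (h b)) ]′ fb

  step-valid : IsExpansion H B → ∀ {Δ G} → (∀ C → Δ C → Valid C) → Step Δ G → Valid G
  step-valid _ valid (resolution {C₁} {C₂} π₁ π₂ _ _ d₁ d₂ G₁ G₂ G' R Ms xs e₁ e₂ θ ag fixed) =
    resolution-valid G₁ G₂ G' R Ms xs θ
      (renamed-valid π₁ (valid C₁ d₁) e₁) (renamed-valid π₂ (valid C₂ d₂) e₂) ag fixed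
  step-valid _ valid (beta {C} π _ d G₁ G₂ P P' e bh) =
    beta-valid G₁ G₂ bh (renamed-valid π (valid C d) e)
  step-valid expansion valid (constraint-refutation {C} π _ d G e fbs (β , hs)) =
    contradiction (trans (sym (constraint-falsified expansion β G fbs hs)) (B⊨G (topValuation β))) λ ()
    where
      B⊨G = proj₂ (renamed-valid π (valid C d) e)

  ⇒*-valid : IsExpansion H B → ∀ {Γ Δ} → Γ ⇒* Δ → (∀ C → Γ C → Valid C) → ∀ C → Δ C → Valid C
  ⇒*-valid expansion ⇒*-refl                valid = valid
  ⇒*-valid expansion (⇒*-step Γ⇒*Δ _)    valid C (inj₁ d)    = ⇒*-valid expansion Γ⇒*Δ valid C d
  ⇒*-valid expansion (⇒*-step Γ⇒*Δ step) valid C (inj₂ refl) =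
    step-valid expansion (⇒*-valid expansion Γ⇒*Δ valid) step

mainTheorem2 : (S : Sig) → FirstOrderSig S → (A : FOStructure S) → (E : Ext S) →
    (H : PreFrame (D A)) → IsFrame H → Expands S A H →
    (Γ : Clauses.Clause S E A → Set) →
    (∀ C → Γ C → Clauses.IsHoCHC S E A C) →
    (Σ (Clauses.Clause S E A → Set) λ Γ' →
       Clauses._⇒*_ S E A Γ (Clauses._∪｛_｝ S E A Γ' (Clauses.⊥clause S E A))) →
    ¬ Clauses.Satisfiable S E A H Γ
mainTheorem2 S _ A E H frame _ Γ hochc (_ , Γ⇒*⊥) (B , expansion , B⊨Γ) =
  contradiction (proj₂ ⊥-valid someValuation) λ ()
  where
    open Clauses S E A using (⊥clause)
    open Soundness S E A H frame B
    ⊥-valid : Valid ⊥clause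
    ⊥-valid = ⇒*-valid expansion Γ⇒*⊥ (λ C γ → hoCHC-valid C (hochc C γ) (B⊨Γ C γ)) ⊥clause (inj₂ refl)
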